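{- Consider buyers $B$ and items $I$, where each buyer $b$ has a budget $C_b>0$ and a value $v_b(i)\in[0,C_b]$ for each item $i$ (a fixed weight per buyer-item pair), and buyer $b$'s value for a bundle $I'\subseteq I$ is $\min\{\sum_{i\in I'}v_b(i),C_b\}$. Let $G$ be the greedy assignment obtained as follows: process all buyer-item pairs $(b,i)$ in non-increasing order of $v_b(i)$; when $(b,i)$ is processed, if $i$ is already assigned or $b$ is blocked, skip it; otherwise, if the total value already assigned to $b$ plus $v_b(i)$ is at most $C_b$, assign $i$ to $b$, and else mark $b$ as blocked forever. Let $w(G)=\sum_{b}\sum_{i\text{ assigned to }b}v_b(i)$. Then $w(G)\ge\frac13\,\mathsf{OPT}$, where $\mathsf{OPT}$ is the maximum of $\sum_{b\in B}\min\{\sum_{i\in I_b}v_b(i),C_b\}$ over all assignments of pairwise disjoint bundles $I_b\subseteq I$.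
   Context: In the paper this is applied with $v_b(i)$ equal to the single samples of the budget-additive combinatorial auction. The assumption $v_b(i)\le C_b$ is the paper's standing modeling convention for this setting.
   Formalization: The budgets $C_b$ and the values $v_b(i)$ are rational. -}

module Defs where

open import Data.Nat using (ℕ; zero; suc)
open import Data.Fin using (Fin; zero; suc; _≟_)
open import Data.Fin.Base using ()
open import Data.List using (List; []; _∷_; foldl; allFin; cartesianProduct)
open import Data.List.Relation.Unary.Linked using (Linked)
open import Data.List.Relation.Binary.Permutation.Propositional using (_↭_)
open import Data.Maybe using (Maybe; just; nothing)
open import Data.Bool using (Bool; true; false)
open import Data.Product using (_×_; _,_)
open import Data.Rational using (ℚ; 0ℚ; _+_; _⊓_; _≤_)
open import Data.Rational.Properties using (_≤?_)
open import Relation.Nullary using (yes; no)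

Σ : ∀ {n} → (Fin n → ℚ) → ℚ
Σ {zero}  f = 0ℚ
Σ {suc n} f = f zero + Σ (λ i → f (suc i))

-- An assignment of pairwise disjoint bundles: each item goes to at most one buyer.
Assignment : ℕ → ℕ → Set
Assignment nB nI = Fin nI → Maybe (Fin nB)

inBundle : ∀ {nB nI} → Assignment nB nI → (Fin nB → Fin nI → ℚ) → Fin nB → Fin nI → ℚ
inBundle A v b i with A i
... | nothing = 0ℚ
... | just b' with b ≟ b'
...   | yes _ = v b i
...   | no  _ = 0ℚ

bundleSum : ∀ {nB nI} → Assignment nB nI → (Fin nB → Fin nI → ℚ) → Fin nB → ℚ
bundleSum A v b = Σ (inBundle A v b)

welfare : ∀ {nB nI} → (Fin nB → ℚ) → (Fin nB → Fin nI → ℚ) → Assignment nB nI → ℚ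
welfare C v A = Σ (λ b → bundleSum A v b ⊓ C b)

weight : ∀ {nB nI} → (Fin nB → Fin nI → ℚ) → Assignment nB nI → ℚ
weight v A = Σ (λ b → bundleSum A v b)

allPairs : ∀ nB nI → List (Fin nB × Fin nI)
allPairs nB nI = cartesianProduct (allFin nB) (allFin nI)

IsGreedyOrder : ∀ {nB nI} → (Fin nB → Fin nI → ℚ) → List (Fin nB × Fin nI) → Set
IsGreedyOrder {nB} {nI} v ord =
  (ord ↭ allPairs nB nI) ×
  Linked (λ { (b , i) (b' , i') → v b' i' ≤ v b i }) ord

record GState (nB nI : ℕ) : Set where
  constructor st
  field
    asg     : Assignment nB nI
    blocked : Fin nB → Bool
    load    : Fin nB → ℚ
open GState public

initState : ∀ {nB nI} → GState nB nI
initState = st (λ _ → nothing) (λ _ → false) (λ _ → 0ℚ)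

update : ∀ {n} {A : Set} → (Fin n → A) → Fin n → A → (Fin n → A)
update f k a j with j ≟ k
... | yes _ = a
... | no  _ = f j

step : ∀ {nB nI} → (Fin nB → ℚ) → (Fin nB → Fin nI → ℚ) →
       GState nB nI → Fin nB × Fin nI → GState nB nI
step C v s (b , i) with asg s i | blocked s b
... | just _  | _    = s
... | nothing | true = s
... | nothing | false with load s b + v b i ≤? C b
...   | yes _ = st (update (asg s) i (just b)) (blocked s) (update (load s) b (load s b + v b i))
...   | no  _ = st (asg s) (update (blocked s) b true) (load s)

greedy : ∀ {nB nI} → (Fin nB → ℚ) → (Fin nB → Fin nI → ℚ) →
         List (Fin nB × Fin nI) → Assignment nB nI
greedy C v ord = asg (foldl (step C v) initState ord)

-- Charge the welfare of an arbitrary assignment A, buyer by buyer, to the greedy assignment G.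
-- Pairs are processed by non-increasing value, so an item that overflows a buyer's budget is
-- worth no more than what the buyer already holds: a buyer blocked by the greedy holds more
-- than half its budget, and its budget is paid for twice by its own greedy bundle. A buyer
-- never blocked saw every pair (b , i) processed while active, so item i went to b or already
-- belonged to a buyer valuing it at least v b i; its bundle in A is paid for by the greedy
-- values of its items, which over the disjoint bundles of A add up to at most w(G).
module Submission where

open import Defs
open import Data.Nat using (ℕ; zero; suc)
open import Data.Fin using (Fin; zero; suc; _≟_)
open import Data.Fin.Properties using (punchInᵢ≢i)
open import Data.List using (List; []; _∷_; foldl)
open import Data.List.Relation.Unary.All as All using (All; []; _∷_)
open import Data.List.Relation.Unary.AllPairs using (AllPairs; []; _∷_)
open import Data.List.Relation.Unary.Linked.Properties using (Linked⇒AllPairs)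
open import Data.List.Membership.Propositional.Properties using (∈-cartesianProduct⁺; ∈-allFin)
open import Data.List.Relation.Binary.Permutation.Propositional using (↭-sym)
open import Data.List.Relation.Binary.Permutation.Propositional.Properties using (∈-resp-↭)
open import Data.Product using (_×_; _,_; proj₁; proj₂; ∃-syntax)
open import Data.Sum using (_⊎_; inj₁; inj₂)
open import Data.Rational using (ℚ; 0ℚ; _<_; _≤_; _*_; 1ℚ; _+_; _⊓_)
open import Data.Rational.Properties
  using (_≤?_; <⇒≤; <-≤-trans; ≰⇒>; ≤-refl; ≤-trans; +-mono-≤; +-monoˡ-≤; +-monoʳ-≤; +-identityˡ; +-identityʳ; +-comm;
         +-0-commutativeMonoid; p⊓q≤p; p⊓q≤q; module ≤-Reasoning)
open import Data.Maybe using (just; nothing; maybe)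
open import Data.Maybe.Properties using (just-injective)
open import Data.Bool using (true; false)
open import Data.Empty using (⊥-elim)
open import Data.Vec.Functional using (removeAt)
open import Function using (_∘_; case_of_)
open import Relation.Binary.PropositionalEquality
open import Relation.Nullary using (yes; no; ¬_)
open import Data.Rational.Solver using (module +-*-Solver)
open import Algebra.Properties.CommutativeMonoid.Sum +-0-commutativeMonoid
  using (sum; sum-cong-≗; sum-replicate-zero; sum-remove; ∑-distrib-+; ∑-comm)

Σ≗sum : ∀ {n} (f : Fin n → ℚ) → Σ f ≡ sum f
Σ≗sum {zero}  f = refl
Σ≗sum {suc n} f = cong (f zero +_) (Σ≗sum (f ∘ suc))

Σ-cong : ∀ {n} {f g : Fin n → ℚ} → (∀ i → f i ≡ g i) → Σ f ≡ Σ g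
Σ-cong {f = f} {g} f≗g = trans (Σ≗sum f) (trans (sum-cong-≗ f≗g) (sym (Σ≗sum g)))

Σ-mono-≤ : ∀ {n} {f g : Fin n → ℚ} → (∀ i → f i ≤ g i) → Σ f ≤ Σ g
Σ-mono-≤ {zero}  f≤g = ≤-refl
Σ-mono-≤ {suc n} f≤g = +-mono-≤ (f≤g zero) (Σ-mono-≤ (f≤g ∘ suc))

Σ-zero : ∀ {n} {f : Fin n → ℚ} → (∀ i → f i ≡ 0ℚ) → Σ f ≡ 0ℚ
Σ-zero {n} f≗0 = trans (Σ-cong {g = λ _ → 0ℚ} f≗0) (trans (Σ≗sum {n} (λ _ → 0ℚ)) (sum-replicate-zero n))

Σ-nonneg : ∀ {n} {f : Fin n → ℚ} → (∀ i → 0ℚ ≤ f i) → 0ℚ ≤ Σ f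
Σ-nonneg {n} {f} 0≤f = subst (_≤ Σ f) (Σ-zero {n} λ _ → refl) (Σ-mono-≤ 0≤f)

Σ-distrib-+ : ∀ {n} (f g : Fin n → ℚ) → Σ (λ i → f i + g i) ≡ Σ f + Σ g
Σ-distrib-+ f g = begin
  Σ (λ i → f i + g i)   ≡⟨ Σ≗sum (λ i → f i + g i) ⟩
  sum (λ i → f i + g i) ≡⟨ ∑-distrib-+ f g ⟩
  sum f + sum g         ≡⟨ sym (cong₂ _+_ (Σ≗sum f) (Σ≗sum g)) ⟩
  Σ f + Σ g             ∎
  where open ≡-Reasoning

Σ-comm : ∀ {m n} (f : Fin m → Fin n → ℚ) → Σ (λ i → Σ (f i)) ≡ Σ (λ j → Σ (λ i → f i j))
Σ-comm f = begin
  Σ (λ i → Σ (f i))             ≡⟨ trans (Σ-cong (Σ≗sum ∘ f)) (Σ≗sum (λ i → sum (f i))) ⟩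
  sum (λ i → sum (f i))         ≡⟨ ∑-comm f ⟩
  sum (λ j → sum (λ i → f i j)) ≡⟨ sym (trans (Σ-cong (λ j → Σ≗sum (λ i → f i j)))
                                                (Σ≗sum (λ j → sum (λ i → f i j)))) ⟩
  Σ (λ j → Σ (λ i → f i j))     ∎
  where open ≡-Reasoning

Σ-extend : ∀ {n} {f g : Fin n → ℚ} k → f k ≡ 0ℚ → (∀ j → j ≢ k → g j ≡ f j) → Σ g ≡ Σ f + g k
Σ-extend {suc n} {f} {g} k fk≡0 g≗f = begin
  Σ g                      ≡⟨ Σ≗sum g ⟩
  sum g                    ≡⟨ sum-remove g ⟩
  g k + sum (removeAt g k) ≡⟨ cong (g k +_) (sum-cong-≗ (λ j → g≗f _ (punchInᵢ≢i k j))) ⟩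
  g k + sum (removeAt f k) ≡⟨ cong (g k +_) (sym sum-f) ⟩
  g k + sum f              ≡⟨ +-comm (g k) (sum f) ⟩
  sum f + g k              ≡⟨ cong (_+ g k) (sym (Σ≗sum f)) ⟩
  Σ f + g k                ∎
  where
  open ≡-Reasoning
  sum-f : sum f ≡ sum (removeAt f k)
  sum-f = trans (sum-remove f) (trans (cong (_+ sum (removeAt f k)) fk≡0) (+-identityˡ _))

Σ-single : ∀ {n} {g : Fin n → ℚ} k → (∀ j → j ≢ k → g j ≡ 0ℚ) → Σ g ≡ g k
Σ-single {n} {g} k g≗0 = begin
  Σ g                    ≡⟨ Σ-extend {f = λ _ → 0ℚ} k refl g≗0 ⟩
  Σ {n} (λ _ → 0ℚ) + g k ≡⟨ cong (_+ g k) (Σ-zero {n} λ _ → refl) ⟩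
  0ℚ + g k               ≡⟨ +-identityˡ (g k) ⟩
  g k                    ∎
  where open ≡-Reasoning

p≤q+p : ∀ {p q} → 0ℚ ≤ q → p ≤ q + p
p≤q+p {p} {q} 0≤q = subst (_≤ q + p) (+-identityˡ p) (+-monoˡ-≤ p 0≤q)

p≤p+q : ∀ {p q} → 0ℚ ≤ q → p ≤ p + q
p≤p+q {p} {q} 0≤q = subst (p ≤_) (+-comm q p) (p≤q+p 0≤q)

update-≡ : ∀ {n} {A : Set} (f : Fin n → A) k a → update f k a k ≡ a
update-≡ f k a with k ≟ k
... | yes _   = refl
... | no k≢k = ⊥-elim (k≢k refl)

update-≢ : ∀ {n} {A : Set} (f : Fin n → A) k a {j} → j ≢ k → update f k a j ≡ f j
update-≢ f k a {j} j≢k with j ≟ k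
... | yes j≡k = ⊥-elim (j≢k j≡k)
... | no _    = refl

update-preserves : ∀ {n} {A : Set} (f : Fin n → A) k {a j} → f j ≡ a → update f k a j ≡ a
update-preserves f k {j = j} fj≡a with j ≟ k
... | yes _ = refl
... | no _  = fj≡a

ownerValue : ∀ {nB nI} → Assignment nB nI → (Fin nB → Fin nI → ℚ) → Fin nI → ℚ
ownerValue A w i = maybe (λ b → w b i) 0ℚ (A i)

inBundle-cong : ∀ {nB nI} {A A' : Assignment nB nI} {w b i} → A i ≡ A' i → inBundle A w b i ≡ inBundle A' w b i
inBundle-cong {A = A} {A'} {i = i} Ai≡A'i with A i | A' i | Ai≡A'i
... | _ | _ | refl = refl

module _ {nB nI : ℕ} {A : Assignment nB nI} where

  inBundle-owner : ∀ {w b i} → A i ≡ just b → inBundle A w b i ≡ w b i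
  inBundle-owner {b = b} {i} Ai≡b with A i
  ... | just b' with refl ← Ai≡b with b ≟ b
  ...   | yes _   = refl
  ...   | no b≢b = ⊥-elim (b≢b refl)

  inBundle-nonowner : ∀ {w b i} → A i ≢ just b → inBundle A w b i ≡ 0ℚ
  inBundle-nonowner {b = b} {i} Ai≢b with A i
  ... | nothing = refl
  ... | just b' with b ≟ b'
  ...   | yes refl = ⊥-elim (Ai≢b refl)
  ...   | no _     = refl

  bundleSum-mono-≤ : ∀ {w w' b} → (∀ i → w b i ≤ w' b i) → bundleSum A w b ≤ bundleSum A w' b
  bundleSum-mono-≤ {w} {w'} {b} w≤w' = Σ-mono-≤ pointwise
    where
    pointwise : ∀ i → inBundle A w b i ≤ inBundle A w' b i
    pointwise i with A i
    ... | nothing = ≤-refl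
    ... | just b' with b ≟ b'
    ...   | yes _ = w≤w' i
    ...   | no _  = ≤-refl

  bundleSum-nonneg : ∀ {w b} → (∀ i → 0ℚ ≤ w b i) → 0ℚ ≤ bundleSum A w b
  bundleSum-nonneg {w} {b} 0≤w = Σ-nonneg pointwise
    where
    pointwise : ∀ i → 0ℚ ≤ inBundle A w b i
    pointwise i with A i
    ... | nothing = ≤-refl
    ... | just b' with b ≟ b'
    ...   | yes _ = 0≤w i
    ...   | no _  = ≤-refl

  ownerValue-owner : ∀ {w b i} → A i ≡ just b → ownerValue A w i ≡ w b i
  ownerValue-owner {w} {i = i} = cong (maybe (λ b → w b i) 0ℚ)

  ownerValue-nonneg : ∀ {w} → (∀ b i → 0ℚ ≤ w b i) → ∀ i → 0ℚ ≤ ownerValue A w i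
  ownerValue-nonneg {w} 0≤w i with A i
  ... | nothing = ≤-refl
  ... | just b  = 0≤w b i

  Σ-inBundle : ∀ {w} i → Σ (λ b → inBundle A w b i) ≡ ownerValue A w i
  Σ-inBundle {w} i = by-owner (A i) refl
    where
    by-owner : ∀ m → A i ≡ m → Σ (λ b → inBundle A w b i) ≡ maybe (λ b → w b i) 0ℚ m
    by-owner nothing  Ai≡ = Σ-zero (λ b → inBundle-nonowner {w = w} {b} λ Ai≡b → case trans (sym Ai≡) Ai≡b of λ ())
    by-owner (just b₀) Ai≡ =
      trans (Σ-single b₀ (λ b b≢b₀ → inBundle-nonowner {w = w} {b} λ Ai≡b → b≢b₀ (just-injective (trans (sym Ai≡b) Ai≡))))
            (inBundle-owner Ai≡)

  weight≡Σ-ownerValue : ∀ w → weight w A ≡ Σ (ownerValue A w)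
  weight≡Σ-ownerValue w = trans (Σ-comm (λ b i → inBundle A w b i)) (Σ-cong Σ-inBundle)

  weight-uniform-≤ : ∀ {g : Fin nI → ℚ} → (∀ i → 0ℚ ≤ g i) → weight (λ _ → g) A ≤ Σ g
  weight-uniform-≤ {g} 0≤g = subst (_≤ Σ g) (sym (weight≡Σ-ownerValue (λ _ → g))) (Σ-mono-≤ pointwise)
    where
    pointwise : ∀ i → ownerValue A (λ _ → g) i ≤ g i
    pointwise i with A i
    ... | nothing = 0≤g i
    ... | just _  = ≤-refl

  bundleSum-assign : ∀ {w b b' i} → A i ≡ nothing →
    bundleSum (update A i (just b')) w b ≡ bundleSum A w b + inBundle (update A i (just b')) w b i
  bundleSum-assign {w} {b} {b'} {i} Ai≡nothing =
    Σ-extend i (inBundle-nonowner {w = w} {b} λ Ai≡b → case trans (sym Ai≡nothing) Ai≡b of λ ())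
               (λ j j≢i → inBundle-cong {A = update A i (just b')} {A} {w} {b} (update-≢ A i (just b') j≢i))

module Greedy {nB nI : ℕ} (C : Fin nB → ℚ) (v : Fin nB → Fin nI → ℚ)
              (0≤v : ∀ b i → 0ℚ ≤ v b i) (v≤C : ∀ b i → v b i ≤ C b) where

  State : Set
  State = GState nB nI

  Pair : Set
  Pair = Fin nB × Fin nI

  _≽_ : Pair → Pair → Set
  (b , i) ≽ (b' , i') = v b' i' ≤ v b i

  assignItem : State → Fin nB → Fin nI → State
  assignItem s b i = st (update (asg s) i (just b)) (blocked s) (update (load s) b (load s b + v b i))

  blockBuyer : State → Fin nB → State
  blockBuyer s b = st (asg s) (update (blocked s) b true) (load s)

  data StepView (s : State) (b : Fin nB) (i : Fin nI) : State → Set where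
    taken    : ∀ {b'} → asg s i ≡ just b' → StepView s b i s
    frozen   : blocked s b ≡ true → StepView s b i s
    assign   : asg s i ≡ nothing → blocked s b ≡ false → StepView s b i (assignItem s b i)
    overflow : ¬ (load s b + v b i ≤ C b) → StepView s b i (blockBuyer s b)

  step-view : ∀ s b i → StepView s b i (step C v s (b , i))
  step-view s b i with asg s i in Ai | blocked s b in blk
  ... | just _  | _     = taken Ai
  ... | nothing | true  = frozen blk
  ... | nothing | false with load s b + v b i ≤? C b
  ...   | yes _    = assign Ai blk
  ...   | no ¬fits = overflow ¬fits

  LoadIsBundleSum : State → Set
  LoadIsBundleSum s = ∀ b → load s b ≡ bundleSum (asg s) v b

  BlockedHalfFull : State → Set
  BlockedHalfFull s = ∀ b → blocked s b ≡ true → C b ≤ load s b + load s b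

  Invariant : State → Set
  Invariant s = LoadIsBundleSum s × BlockedHalfFull s

  OwnerOutbids : State → Pair → Set
  OwnerOutbids s (b , i) = ∀ {b'} → asg s i ≡ just b' → v b i ≤ v b' i

  LoadOutweighs : State → Pair → Set
  LoadOutweighs s (b , i) = load s b ≡ 0ℚ ⊎ v b i ≤ load s b

  -- Maintained for the pairs not yet processed; preserving it is where the order is used.
  Pending : State → Pair → Set
  Pending s p = OwnerOutbids s p × LoadOutweighs s p

  Covered : State → Pair → Set
  Covered s (b , i) = blocked s b ≡ true ⊎ ∃[ b' ] (asg s i ≡ just b' × v b i ≤ v b' i)

  load-nonneg : ∀ {s} → LoadIsBundleSum s → ∀ b → 0ℚ ≤ load s b
  load-nonneg {s} exact b = subst (0ℚ ≤_) (sym (exact b)) (bundleSum-nonneg {A = asg s} (0≤v b))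

  assign-loadIsBundleSum : ∀ {s b i} → asg s i ≡ nothing → LoadIsBundleSum s → LoadIsBundleSum (assignItem s b i)
  assign-loadIsBundleSum {s} {b} {i} free exact b' = begin
    update (load s) b (load s b + v b i) b'               ≡⟨ increment ⟩
    bundleSum (asg s) v b' + inBundle (asg s′) v b' i    ≡⟨ sym (bundleSum-assign {A = asg s} {v} {b'} {b} free) ⟩
    bundleSum (asg s′) v b'                               ∎
    where
    open ≡-Reasoning
    s′ = assignItem s b i
    owned : asg s′ i ≡ just b
    owned = update-≡ (asg s) i (just b)
    increment : update (load s) b (load s b + v b i) b' ≡ bundleSum (asg s) v b' + inBundle (asg s′) v b' i
    increment with b' ≟ b
    ... | yes refl = cong₂ _+_ (exact b) (sym (inBundle-owner {A = asg s′} {v} {i = i} owned))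
    ... | no b'≢b  = begin
      load s b'                                          ≡⟨ exact b' ⟩
      bundleSum (asg s) v b'                             ≡⟨ sym (+-identityʳ (bundleSum (asg s) v b')) ⟩
      bundleSum (asg s) v b' + 0ℚ                        ≡⟨ cong (bundleSum (asg s) v b' +_) (sym not-owned) ⟩
      bundleSum (asg s) v b' + inBundle (asg s′) v b' i ∎
      where
      not-owned : inBundle (asg s′) v b' i ≡ 0ℚ
      not-owned = inBundle-nonowner {A = asg s′} {v} {b'} {i} λ owned' → b'≢b (just-injective (trans (sym owned') owned))

  assign-blockedHalfFull : ∀ {s b i} → blocked s b ≡ false → BlockedHalfFull s → BlockedHalfFull (assignItem s b i)
  assign-blockedHalfFull {b = b} unblocked half b' blk with b' ≟ b
  ... | yes refl = case trans (sym blk) unblocked of λ ()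
  ... | no _     = half b' blk

  -- An empty load cannot overflow since v ≤ C; otherwise the item is worth at most the load.
  overflow-blockedHalfFull : ∀ {s b i} → LoadOutweighs s (b , i) → ¬ (load s b + v b i ≤ C b) →
                             BlockedHalfFull s → BlockedHalfFull (blockBuyer s b)
  overflow-blockedHalfFull {s} {b} {i} outweighs ¬fits half b' blk with b' ≟ b | outweighs
  ... | no _     | _             = half b' blk
  ... | yes refl | inj₁ empty    = ⊥-elim (¬fits (subst (λ l → l + v b i ≤ C b) (sym empty)
                                                        (subst (_≤ C b) (sym (+-identityˡ (v b i))) (v≤C b i))))
  ... | yes refl | inj₂ v≤load = <⇒≤ (<-≤-trans (≰⇒> ¬fits) (+-monoʳ-≤ (load s b) v≤load))

  step-invariant : ∀ {s b i} → Pending s (b , i) → Invariant s → Invariant (step C v s (b , i))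
  step-invariant {s} {b} {i} (_ , outweighs) inv@(exact , half) with step C v s (b , i) | step-view s b i
  ... | _ | taken _            = inv
  ... | _ | frozen _           = inv
  ... | _ | assign free unblk  = assign-loadIsBundleSum {s} free exact , assign-blockedHalfFull {s} unblk half
  ... | _ | overflow ¬fits     = exact , overflow-blockedHalfFull {s} outweighs ¬fits half

  assign-ownerOutbids : ∀ {s b i b' j} → (b , i) ≽ (b' , j) →
                        OwnerOutbids s (b' , j) → OwnerOutbids (assignItem s b i) (b' , j)
  assign-ownerOutbids {i = i} {j = j} x≽p outbids owned with j ≟ i
  ... | yes refl with refl ← owned = x≽p
  ... | no _                        = outbids owned

  assign-loadOutweighs : ∀ {s b i b' j} → LoadIsBundleSum s → (b , i) ≽ (b' , j) →
                         LoadOutweighs s (b' , j) → LoadOutweighs (assignItem s b i) (b' , j)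
  assign-loadOutweighs {s} {b} {b' = b'} exact x≽p outweighs with b' ≟ b
  ... | yes refl = inj₂ (≤-trans x≽p (p≤q+p (load-nonneg {s} exact b)))
  ... | no _     = outweighs

  step-pending : ∀ {s b i p} → Invariant s → (b , i) ≽ p → Pending s p → Pending (step C v s (b , i)) p
  step-pending {s} {b} {i} (exact , _) x≽p pend@(outbids , outweighs) with step C v s (b , i) | step-view s b i
  ... | _ | taken _    = pend
  ... | _ | frozen _   = pend
  ... | _ | assign _ _ = assign-ownerOutbids {s} x≽p outbids , assign-loadOutweighs {s} exact x≽p outweighs
  ... | _ | overflow _ = pend

  step-covers : ∀ {s b i} → OwnerOutbids s (b , i) → Covered (step C v s (b , i)) (b , i)
  step-covers {s} {b} {i} outbids with step C v s (b , i) | step-view s b i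
  ... | _ | taken owned = inj₂ (_ , owned , outbids owned)
  ... | _ | frozen blk  = inj₁ blk
  ... | _ | assign _ _  = inj₂ (b , update-≡ (asg s) i (just b) , ≤-refl)
  ... | _ | overflow _  = inj₁ (update-≡ (blocked s) b true)

  step-keeps-owner : ∀ {s b i j b'} → asg s j ≡ just b' → asg (step C v s (b , i)) j ≡ just b'
  step-keeps-owner {s} {b} {i} {j} owned with step C v s (b , i) | step-view s b i
  ... | _ | taken _     = owned
  ... | _ | frozen _    = owned
  ... | _ | assign free _ = trans (update-≢ (asg s) i (just b) j≢i) owned
    where
    j≢i : j ≢ i
    j≢i refl = case trans (sym free) owned of λ ()
  ... | _ | overflow _  = owned

  step-keeps-blocked : ∀ {s b i b'} → blocked s b' ≡ true → blocked (step C v s (b , i)) b' ≡ true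
  step-keeps-blocked {s} {b} {i} blk with step C v s (b , i) | step-view s b i
  ... | _ | taken _    = blk
  ... | _ | frozen _   = blk
  ... | _ | assign _ _ = blk
  ... | _ | overflow _ = update-preserves (blocked s) b blk

  step-keeps-covered : ∀ {s b i p} → Covered s p → Covered (step C v s (b , i)) p
  step-keeps-covered {s} (inj₁ blk)                = inj₁ (step-keeps-blocked {s} blk)
  step-keeps-covered {s} (inj₂ (b' , owned , le)) = inj₂ (b' , step-keeps-owner {s} owned , le)

  run : State → List Pair → State
  run = foldl (step C v)

  step-pending-all : ∀ {s x l} → Invariant s → All (x ≽_) l → All (Pending s) l → All (Pending (step C v s x)) l
  step-pending-all     inv []            []             = []
  step-pending-all {s} inv (x≽p ∷ x≽ps) (pend ∷ pends) =
    step-pending {s} inv x≽p pend ∷ step-pending-all {s} inv x≽ps pends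

  run-invariant : ∀ {s l} → AllPairs _≽_ l → Invariant s → All (Pending s) l → Invariant (run s l)
  run-invariant         []             inv []             = inv
  run-invariant {s} (x≽l ∷ sorted) inv (pend ∷ pends) =
    run-invariant sorted (step-invariant {s} pend inv) (step-pending-all {s} inv x≽l pends)

  run-keeps-covered : ∀ {s p} l → Covered s p → Covered (run s l) p
  run-keeps-covered []      cov = cov
  run-keeps-covered {s} (_ ∷ l) cov = run-keeps-covered l (step-keeps-covered {s} cov)

  run-covers : ∀ {s l} → AllPairs _≽_ l → Invariant s → All (Pending s) l → All (Covered (run s l)) l
  run-covers                 []             inv []             = []
  run-covers {s} {_ ∷ l} (x≽l ∷ sorted) inv (pend ∷ pends) =
    run-keeps-covered l (step-covers {s} (proj₁ pend)) ∷
    run-covers sorted (step-invariant {s} pend inv) (step-pending-all {s} inv x≽l pends)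

  init-invariant : Invariant initState
  init-invariant = (λ _ → sym (Σ-zero {nI} λ _ → refl)) , λ b ()

  init-pending : ∀ {l} → All (Pending initState) l
  init-pending = All.tabulate λ _ → (λ ()) , inj₁ refl

  module _ {ord : List Pair} (order : IsGreedyOrder v ord) where

    greedyState : State
    greedyState = run initState ord

    sorted : AllPairs _≽_ ord
    sorted = Linked⇒AllPairs (λ x≽y y≽z → ≤-trans y≽z x≽y) (proj₂ order)

    greedy-invariant : Invariant greedyState
    greedy-invariant = run-invariant sorted init-invariant init-pending

    greedy-covers : ∀ b i → Covered greedyState (b , i)
    greedy-covers b i = All.lookup (run-covers sorted init-invariant init-pending)
      (∈-resp-↭ (↭-sym (proj₁ order)) (∈-cartesianProduct⁺ (∈-allFin b) (∈-allFin i)))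

  covered-unblocked : ∀ {s b i} → Covered s (b , i) → blocked s b ≡ false → v b i ≤ ownerValue (asg s) v i
  covered-unblocked     (inj₁ blk)                unblk = case trans (sym blk) unblk of λ ()
  covered-unblocked {s} (inj₂ (b' , owned , le)) _     = subst (_ ≤_) (sym (ownerValue-owner {A = asg s} {v} owned)) le

  buyer-bound : ∀ {s} → Invariant s → (∀ b i → Covered s (b , i)) → ∀ A b →
    bundleSum A v b ⊓ C b ≤ (bundleSum (asg s) v b + bundleSum (asg s) v b) + bundleSum A (λ _ → ownerValue (asg s) v) b
  buyer-bound {s} (exact , half) covered A b with blocked s b in blk
  ... | true = begin
    bundleSum A v b ⊓ C b ≤⟨ p⊓q≤q (bundleSum A v b) (C b) ⟩
    C b                   ≤⟨ half b blk ⟩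
    load s b + load s b   ≡⟨ cong₂ _+_ (exact b) (exact b) ⟩
    G + G                 ≤⟨ p≤p+q (bundleSum-nonneg {A = A} (λ _ → ownerValue-nonneg {A = asg s} 0≤v _)) ⟩
    (G + G) + H           ∎
    where
    open ≤-Reasoning
    G = bundleSum (asg s) v b
    H = bundleSum A (λ _ → ownerValue (asg s) v) b
  ... | false = begin
    bundleSum A v b ⊓ C b ≤⟨ p⊓q≤p (bundleSum A v b) (C b) ⟩
    bundleSum A v b       ≤⟨ bundleSum-mono-≤ {A = A} (λ i → covered-unblocked {s} (covered b i) blk) ⟩
    H                     ≤⟨ p≤q+p (+-mono-≤ G-nonneg G-nonneg) ⟩
    (G + G) + H           ∎
    where
    open ≤-Reasoning
    G = bundleSum (asg s) v b
    H = bundleSum A (λ _ → ownerValue (asg s) v) b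
    G-nonneg : 0ℚ ≤ G
    G-nonneg = bundleSum-nonneg {A = asg s} (0≤v b)

three-times : ∀ p → (1ℚ + 1ℚ + 1ℚ) * p ≡ (p + p) + p
three-times = solve 1 (λ p → (con 1ℚ :+ con 1ℚ :+ con 1ℚ) :* p := (p :+ p) :+ p) refl
  where open +-*-Solver

lemma7 : (nB nI : ℕ) (C : Fin nB → ℚ) (v : Fin nB → Fin nI → ℚ) →
    (∀ b → 0ℚ < C b) →
    (∀ b i → 0ℚ ≤ v b i) →
    (∀ b i → v b i ≤ C b) →
    (ord : List (Fin nB × Fin nI)) → IsGreedyOrder v ord →
    (A : Assignment nB nI) →
    welfare C v A ≤ (1ℚ + 1ℚ + 1ℚ) * weight v (greedy C v ord)
lemma7 nB nI C v _ 0≤v v≤C ord order A = begin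
  welfare C v A                                 ≤⟨ Σ-mono-≤ (buyer-bound (greedy-invariant order) (greedy-covers order) A) ⟩
  Σ (λ b → (G b + G b) + H b)                   ≡⟨ trans (Σ-distrib-+ (λ b → G b + G b) H) (cong (_+ Σ H) (Σ-distrib-+ G G)) ⟩
  (W + W) + Σ H                                 ≤⟨ +-monoʳ-≤ (W + W) (weight-uniform-≤ {A = A} (ownerValue-nonneg {A = Gₐ} 0≤v)) ⟩
  (W + W) + Σ g                                 ≡⟨ cong ((W + W) +_) (sym (weight≡Σ-ownerValue {A = Gₐ} v)) ⟩
  (W + W) + W                                   ≡⟨ sym (three-times W) ⟩
  (1ℚ + 1ℚ + 1ℚ) * W                            ∎
  where
  open ≤-Reasoning
  open Greedy C v 0≤v v≤C
  Gₐ = greedy C v ord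
  G = bundleSum Gₐ v
  g = ownerValue Gₐ v
  H = bundleSum A (λ _ → g)
  W = weight v Gₐ
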